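{- Let $G$ be a prime bull-free graph. Then $G$ contains no parasol as an induced subgraph.
   Context: Graphs are finite and simple. The bull is the graph with vertices $a,b,c,d,e$ and edges $ab, bc, cd, be, ce$; bull-free means having no induced subgraph isomorphic to the bull. A homogeneous set in $G$ is a set $S\subseteq V(G)$ such that every vertex of $V(G)\setminus S$ is either adjacent to all vertices of $S$ or to none of them; it is proper if $|S|\ge 2$ and $S\neq V(G)$. $G$ is prime if it has no proper homogeneous set. A parasol is the graph on seven vertices $p_1,\dots,p_5,x,y$ with edges $p_ip_{i+1}$ for $i=1,2,3,4$ (an induced path $P_5$), $xp_j$ for $j=1,\dots,5$, and $xy$, and no other edges. -}

module Defs where

open import Data.Nat using (ℕ)
open import Data.Fin using (Fin; zero; suc)
open import Data.Fin.Subset using (Subset; _∈_; _∉_)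
open import Data.Product using (Σ; ∃; ∃-syntax; _×_; _,_)
open import Data.Sum using (_⊎_; inj₁; inj₂)
open import Data.Empty using (⊥)
open import Data.Unit using (⊤)
open import Relation.Nullary using (¬_)
open import Relation.Binary.PropositionalEquality using (_≡_)
open import Function.Definitions using (Injective)
open import Function.Bundles using (_⇔_)
open import Level using (0ℓ)

record Graph (n : ℕ) : Set₁ where
  field
    Adj   : Fin n → Fin n → Set
    sym   : ∀ {u v} → Adj u v → Adj v u
    irrefl : ∀ {v} → ¬ Adj v v
open Graph public

_≼ᵢ_ : ∀ {k n} → Graph k → Graph n → Set
_≼ᵢ_ {k} {n} H G =
  Σ (Fin k → Fin n) λ f →
    Injective _≡_ _≡_ f × (∀ i j → Adj H i j ⇔ Adj G (f i) (f j))

fromEdges : ∀ {k} → (Fin k → Fin k → Set) → Graph k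
fromEdges R = record
  { Adj = λ u v → ¬ (u ≡ v) × (R u v ⊎ R v u)
  ; sym = λ { (ne , inj₁ r) → (λ e → ne (Relation.Binary.PropositionalEquality.sym e)) , inj₂ r
            ; (ne , inj₂ r) → (λ e → ne (Relation.Binary.PropositionalEquality.sym e)) , inj₁ r }
  ; irrefl = λ { (ne , _) → ne Relation.Binary.PropositionalEquality.refl }
  }

-- Bull: vertices a,b,c,d,e = 0..4; edges ab, bc, cd, be, ce.
bullEdge : Fin 5 → Fin 5 → Set
bullEdge zero (suc zero) = ⊤
bullEdge (suc zero) (suc (suc zero)) = ⊤
bullEdge (suc (suc zero)) (suc (suc (suc zero))) = ⊤
bullEdge (suc zero) (suc (suc (suc (suc zero)))) = ⊤
bullEdge (suc (suc zero)) (suc (suc (suc (suc zero)))) = ⊤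
bullEdge _ _ = ⊥

bull : Graph 5
bull = fromEdges bullEdge

BullFree : ∀ {n} → Graph n → Set
BullFree G = ¬ (bull ≼ᵢ G)

-- Parasol: vertices p1..p5 = 0..4, x = 5, y = 6;
-- edges p_i p_{i+1} (i=1..4), x p_j (j=1..5), x y.
parasolEdge : Fin 7 → Fin 7 → Set
parasolEdge zero (suc zero) = ⊤
parasolEdge (suc zero) (suc (suc zero)) = ⊤
parasolEdge (suc (suc zero)) (suc (suc (suc zero))) = ⊤
parasolEdge (suc (suc (suc zero))) (suc (suc (suc (suc zero)))) = ⊤
parasolEdge (suc (suc (suc (suc (suc zero))))) (suc (suc (suc (suc (suc (suc zero)))))) = ⊤
parasolEdge (suc (suc (suc (suc (suc zero))))) (suc (suc (suc (suc (suc _))))) = ⊥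
parasolEdge (suc (suc (suc (suc (suc zero))))) _ = ⊤
parasolEdge _ _ = ⊥

parasol : Graph 7
parasol = fromEdges parasolEdge

Homogeneous : ∀ {n} → Graph n → Subset n → Set
Homogeneous {n} G S =
  ∀ v → v ∉ S → (∀ s → s ∈ S → Adj G v s) ⊎ (∀ s → s ∈ S → ¬ Adj G v s)

Proper : ∀ {n} → Subset n → Set
Proper {n} S = (∃[ u ] ∃[ w ] (u ∈ S × w ∈ S × ¬ (u ≡ w))) × (∃[ v ] v ∉ S)

Prime : ∀ {n} → Graph n → Set
Prime {n} G = ∀ (S : Subset n) → Proper S → ¬ Homogeneous G S

-- Call a vertex an apex if it is complete to the rim p₀ … p₄ of the parasol and has
-- a neighbour anticomplete to the rim; the parasol's own apex x is one. Starting
-- from the edge p₀p₁, grow a connected set S of non-apices to which every apex is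
-- complete, each time adding a vertex w adjacent to exactly one end of an edge ab
-- of S. Such a w is no apex, since it misses b. Every apex c sees w: otherwise,
-- using the handle of c, bull-freeness makes each of w, a, b complete or
-- anticomplete to the rim (for u complete and s anticomplete to the rim, a vertex t
-- is one or the other if it misses both ends of an edge su, if s–t–u is an induced
-- path, or if t sees s but not u), and this always produces an apex among them.
-- When no such w is left, S is a homogeneous set; it is proper because it contains
-- p₀p₁ but not x, contradicting primality.

module Submission where

import Data.Nat as ℕ
open import Data.Fin using (Fin; suc; inject₁)
open import Data.Fin.Patterns using (0F; 1F; 2F; 3F; 4F; 5F; 6F)
open import Data.Fin.Properties using (inject₁-injective; any?)
open import Data.Fin.Subset using (Subset; _∈_; _∉_; _⊆_; _∪_; ⁅_⁆; _⊂_; _⊃_)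
open import Data.Fin.Subset.Properties using (_∈?_; p⊆p∪q; q⊆p∪q; x∈p∪q⁻; x∈⁅x⁆; x∈⁅y⁆⇒x≡y)
open import Data.Fin.Subset.Induction using (⊃-wellFounded)
open import Data.Product using (∃; ∃₂; _×_; _,_; proj₁; proj₂)
open import Data.Sum using (_⊎_; inj₁; inj₂; [_,_])
import Data.Sum as Sum
import Data.Product as Product
open import Data.Empty using (⊥; ⊥-elim)
open import Data.Unit using (⊤; tt)
open import Function.Base using (id; _∘_)
open import Function.Bundles using (_⇔_; mk⇔; Equivalence)
open import Function.Construct.Composition using (_⇔-∘_)
open import Function.Definitions using (Injective)
open import Induction.WellFounded using (Acc; acc)
open import Relation.Binary.Construct.Closure.ReflexiveTransitive using (Star; ε; _◅_)
import Relation.Binary.Construct.Closure.ReflexiveTransitive as Star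
open import Relation.Binary.Definitions using (Decidable)
open import Relation.Binary.PropositionalEquality using (_≡_; _≢_; refl; cong; subst)
import Relation.Binary.PropositionalEquality as ≡
open import Relation.Nullary using (¬_; Dec; yes; no)
open import Relation.Nullary.Decidable using (_×-dec_; ¬?; ¬¬-excluded-middle)
open import Defs

¬¬-∀-Fin : ∀ {m} {Q : Fin m → Set} → (∀ i → ¬ ¬ Q i) → ¬ ¬ (∀ i → Q i)
¬¬-∀-Fin {ℕ.zero}  _ k = k λ ()
¬¬-∀-Fin {ℕ.suc m} h k =
  h 0F λ q₀ → ¬¬-∀-Fin (h ∘ suc) λ qs → k λ { 0F → q₀ ; (suc i) → qs i }

¬¬-decidable : ∀ {n} (G : Graph n) → ¬ ¬ Decidable (Adj G)
¬¬-decidable G = ¬¬-∀-Fin λ u → ¬¬-∀-Fin λ v → ¬¬-excluded-middle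

≼ᵢ-trans : ∀ {k m n} {H : Graph k} {K : Graph m} {G : Graph n} →
           H ≼ᵢ K → K ≼ᵢ G → H ≼ᵢ G
≼ᵢ-trans (f , f-injective , f-induced) (g , g-injective , g-induced) =
  g ∘ f , f-injective ∘ g-injective , λ i j → g-induced (f i) (f j) ⇔-∘ f-induced i j

-- The path P₅ and the bull as induced subgraphs

infix 4 _─_
_─_ : Fin 5 → Fin 5 → Set
0F ─ 1F = ⊤
1F ─ 0F = ⊤
1F ─ 2F = ⊤
2F ─ 1F = ⊤
2F ─ 3F = ⊤
3F ─ 2F = ⊤
3F ─ 4F = ⊤
4F ─ 3F = ⊤
_  ─ _  = ⊥

─-sym : ∀ {i j} → i ─ j → j ─ i
─-sym {0F} {1F} _ = tt
─-sym {1F} {0F} _ = tt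
─-sym {1F} {2F} _ = tt
─-sym {2F} {1F} _ = tt
─-sym {2F} {3F} _ = tt
─-sym {3F} {2F} _ = tt
─-sym {3F} {4F} _ = tt
─-sym {4F} {3F} _ = tt

─-irrefl : ∀ {i} → ¬ i ─ i
─-irrefl {0F} ()
─-irrefl {1F} ()
─-irrefl {2F} ()
─-irrefl {3F} ()
─-irrefl {4F} ()

P₅ : Graph 5
P₅ = fromEdges _─_

rim : Fin 5 → Fin 7
rim = inject₁ ∘ inject₁

P₅≼ᵢparasol : P₅ ≼ᵢ parasol
P₅≼ᵢparasol = rim , rim-injective , λ i j → mk⇔ (to i j) (from i j)
  where
  rim-injective : Injective _≡_ _≡_ rim
  rim-injective = inject₁-injective ∘ inject₁-injective

  rim-edge : ∀ {i j} → i ─ j → parasolEdge (rim i) (rim j) ⊎ parasolEdge (rim j) (rim i)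
  rim-edge {0F} {1F} _ = inj₁ tt
  rim-edge {1F} {0F} _ = inj₂ tt
  rim-edge {1F} {2F} _ = inj₁ tt
  rim-edge {2F} {1F} _ = inj₂ tt
  rim-edge {2F} {3F} _ = inj₁ tt
  rim-edge {3F} {2F} _ = inj₂ tt
  rim-edge {3F} {4F} _ = inj₁ tt
  rim-edge {4F} {3F} _ = inj₂ tt

  edge-rim : ∀ {i j} → parasolEdge (rim i) (rim j) → i ─ j
  edge-rim {0F} {1F} _ = tt
  edge-rim {1F} {2F} _ = tt
  edge-rim {2F} {3F} _ = tt
  edge-rim {3F} {4F} _ = tt
  edge-rim {4F} {_}  ()

  to : ∀ i j → Adj P₅ i j → Adj parasol (rim i) (rim j)
  to i j (i≢j , inj₁ e) = i≢j ∘ rim-injective , rim-edge e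
  to i j (i≢j , inj₂ e) = i≢j ∘ rim-injective , Sum.swap (rim-edge e)

  from : ∀ i j → Adj parasol (rim i) (rim j) → Adj P₅ i j
  from i j (i≢j , e) = i≢j ∘ cong rim , Sum.map edge-rim edge-rim e

induced-bull : ∀ {n} (G : Graph n) (v₀ v₁ v₂ v₃ v₄ : Fin n) →
  Adj G v₀ v₁ → Adj G v₁ v₂ → Adj G v₂ v₃ → Adj G v₁ v₄ → Adj G v₂ v₄ →
  ¬ Adj G v₀ v₂ → ¬ Adj G v₀ v₃ → ¬ Adj G v₀ v₄ → ¬ Adj G v₁ v₃ → ¬ Adj G v₃ v₄ →
  bull ≼ᵢ G
induced-bull {n} G v₀ v₁ v₂ v₃ v₄ e₀₁ e₁₂ e₂₃ e₁₄ e₂₄ n₀₂ n₀₃ n₀₄ n₁₃ n₃₄ =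
  v , injective , λ i j → mk⇔ (to i j) (from i j)
  where
  v : Fin 5 → Fin n
  v 0F = v₀
  v 1F = v₁
  v 2F = v₂
  v 3F = v₃
  v 4F = v₄

  edge : ∀ i j → bullEdge i j → Adj G (v i) (v j)
  edge 0F 1F _ = e₀₁
  edge 1F 2F _ = e₁₂
  edge 2F 3F _ = e₂₃
  edge 1F 4F _ = e₁₄
  edge 2F 4F _ = e₂₄

  to : ∀ i j → Adj bull i j → Adj G (v i) (v j)
  to i j (_ , inj₁ e) = edge i j e
  to i j (_ , inj₂ e) = sym G (edge j i e)

  reflect : ∀ i j → Adj G (v i) (v j) → bullEdge i j ⊎ bullEdge j i
  reflect 0F 1F _ = inj₁ tt
  reflect 1F 0F _ = inj₂ tt
  reflect 1F 2F _ = inj₁ tt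
  reflect 2F 1F _ = inj₂ tt
  reflect 2F 3F _ = inj₁ tt
  reflect 3F 2F _ = inj₂ tt
  reflect 1F 4F _ = inj₁ tt
  reflect 4F 1F _ = inj₂ tt
  reflect 2F 4F _ = inj₁ tt
  reflect 4F 2F _ = inj₂ tt
  reflect 0F 2F h = ⊥-elim (n₀₂ h)
  reflect 2F 0F h = ⊥-elim (n₀₂ (sym G h))
  reflect 0F 3F h = ⊥-elim (n₀₃ h)
  reflect 3F 0F h = ⊥-elim (n₀₃ (sym G h))
  reflect 0F 4F h = ⊥-elim (n₀₄ h)
  reflect 4F 0F h = ⊥-elim (n₀₄ (sym G h))
  reflect 1F 3F h = ⊥-elim (n₁₃ h)
  reflect 3F 1F h = ⊥-elim (n₁₃ (sym G h))
  reflect 3F 4F h = ⊥-elim (n₃₄ h)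
  reflect 4F 3F h = ⊥-elim (n₃₄ (sym G h))
  reflect 0F 0F h = ⊥-elim (irrefl G h)
  reflect 1F 1F h = ⊥-elim (irrefl G h)
  reflect 2F 2F h = ⊥-elim (irrefl G h)
  reflect 3F 3F h = ⊥-elim (irrefl G h)
  reflect 4F 4F h = ⊥-elim (irrefl G h)

  from : ∀ i j → Adj G (v i) (v j) → Adj bull i j
  from i j h = (λ { refl → irrefl G h }) , reflect i j h

  apart : ∀ {x y z} → Adj G x z → ¬ Adj G y z → x ≢ y
  apart x~z y≁z refl = y≁z x~z

  injective : Injective _≡_ _≡_ v
  injective {0F} {0F} _  = refl
  injective {0F} {1F} eq = ⊥-elim (apart e₀₁ (irrefl G) eq)
  injective {0F} {2F} eq = ⊥-elim (apart e₂₃ n₀₃ (≡.sym eq))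
  injective {0F} {3F} eq = ⊥-elim (apart (sym G e₂₃) n₀₂ (≡.sym eq))
  injective {0F} {4F} eq = ⊥-elim (apart (sym G e₂₄) n₀₂ (≡.sym eq))
  injective {1F} {0F} eq = ⊥-elim (apart e₀₁ (irrefl G) (≡.sym eq))
  injective {1F} {1F} _  = refl
  injective {1F} {2F} eq = ⊥-elim (apart e₁₂ (irrefl G) eq)
  injective {1F} {3F} eq = ⊥-elim (apart (sym G e₀₁) (n₀₃ ∘ sym G) eq)
  injective {1F} {4F} eq = ⊥-elim (apart e₁₄ (irrefl G) eq)
  injective {2F} {0F} eq = ⊥-elim (apart e₂₃ n₀₃ eq)
  injective {2F} {1F} eq = ⊥-elim (apart e₁₂ (irrefl G) (≡.sym eq))
  injective {2F} {2F} _  = refl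
  injective {2F} {3F} eq = ⊥-elim (apart e₂₃ (irrefl G) eq)
  injective {2F} {4F} eq = ⊥-elim (apart e₂₄ (irrefl G) eq)
  injective {3F} {0F} eq = ⊥-elim (apart (sym G e₂₃) n₀₂ eq)
  injective {3F} {1F} eq = ⊥-elim (apart (sym G e₀₁) (n₀₃ ∘ sym G) (≡.sym eq))
  injective {3F} {2F} eq = ⊥-elim (apart e₂₃ (irrefl G) (≡.sym eq))
  injective {3F} {3F} _  = refl
  injective {3F} {4F} eq = ⊥-elim (apart (sym G e₁₄) (n₁₃ ∘ sym G) (≡.sym eq))
  injective {4F} {0F} eq = ⊥-elim (apart (sym G e₂₄) n₀₂ eq)
  injective {4F} {1F} eq = ⊥-elim (apart e₁₄ (irrefl G) (≡.sym eq))
  injective {4F} {2F} eq = ⊥-elim (apart e₂₄ (irrefl G) (≡.sym eq))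
  injective {4F} {3F} eq = ⊥-elim (apart (sym G e₁₄) (n₁₃ ∘ sym G) eq)
  injective {4F} {4F} _  = refl

-- Vertex predicates on P₅ that are constant

constant-via-0F : ∀ {N : Fin 5 → Set} → Dec (N 0F) →
  (∀ i → N 0F → N i) → (∀ i → N i → N 0F) → (∀ i → N i) ⊎ (∀ i → ¬ N i)
constant-via-0F (yes n₀) forth back = inj₁ λ i → forth i n₀
constant-via-0F (no ¬n₀) forth back = inj₂ λ i → ¬n₀ ∘ back i

constant-if-closed-along : ∀ {N : Fin 5 → Set} → Dec (N 0F) →
  (∀ i j → i ─ j → N i → N j) → (∀ i → N i) ⊎ (∀ i → ¬ N i)
constant-if-closed-along {N} N₀? along = constant-via-0F N₀? forth back
  where
  forth : ∀ i → N 0F → N i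
  forth 0F = id
  forth 1F = along 0F 1F tt
  forth 2F = along 1F 2F tt ∘ along 0F 1F tt
  forth 3F = along 2F 3F tt ∘ along 1F 2F tt ∘ along 0F 1F tt
  forth 4F = along 3F 4F tt ∘ along 2F 3F tt ∘ along 1F 2F tt ∘ along 0F 1F tt

  back : ∀ i → N i → N 0F
  back 0F = id
  back 1F = along 1F 0F tt
  back 2F = along 1F 0F tt ∘ along 2F 1F tt
  back 3F = along 1F 0F tt ∘ along 2F 1F tt ∘ along 3F 2F tt
  back 4F = along 1F 0F tt ∘ along 2F 1F tt ∘ along 3F 2F tt ∘ along 4F 3F tt

constant-if-closed-across : ∀ {N : Fin 5 → Set} → Dec (N 0F) →
  (∀ i j → ¬ i ─ j → N i → N j) → (∀ i → N i) ⊎ (∀ i → ¬ N i)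
constant-if-closed-across {N} N₀? across = constant-via-0F N₀? forth back
  where
  forth : ∀ i → N 0F → N i
  forth 0F = id
  forth 1F = across 3F 1F (λ ()) ∘ across 0F 3F (λ ())
  forth 2F = across 0F 2F (λ ())
  forth 3F = across 0F 3F (λ ())
  forth 4F = across 0F 4F (λ ())

  back : ∀ i → N i → N 0F
  back 0F = id
  back 1F = across 3F 0F (λ ()) ∘ across 1F 3F (λ ())
  back 2F = across 2F 0F (λ ())
  back 3F = across 3F 0F (λ ())
  back 4F = across 4F 0F (λ ())

module _ {N : Fin 5 → Set} (N? : ∀ i → Dec (N i))
  (run-closed : ∀ i j k → i ─ j → j ─ k → ¬ i ─ k → N i → N j → N k)
  (far-closed : ∀ i j k → i ─ j → ¬ k ─ i → ¬ k ─ j → N i → ¬ N j → N k)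
  where

  private
    all-from-01 : N 0F → N 1F → ∀ i → N i
    all-from-01 n₀ n₁ = λ { 0F → n₀ ; 1F → n₁ ; 2F → n₂ ; 3F → n₃ ; 4F → n₄ }
      where
      n₂ = run-closed 0F 1F 2F tt tt (λ ()) n₀ n₁
      n₃ = run-closed 1F 2F 3F tt tt (λ ()) n₁ n₂
      n₄ = run-closed 2F 3F 4F tt tt (λ ()) n₂ n₃

    all-from-34 : N 3F → N 4F → ∀ i → N i
    all-from-34 n₃ n₄ = λ { 0F → n₀ ; 1F → n₁ ; 2F → n₂ ; 3F → n₃ ; 4F → n₄ }
      where
      n₂ = run-closed 4F 3F 2F tt tt (λ ()) n₄ n₃
      n₁ = run-closed 3F 2F 1F tt tt (λ ()) n₃ n₂
      n₀ = run-closed 2F 1F 0F tt tt (λ ()) n₂ n₁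

    all-from-0 : N 0F → ∀ k → N k
    all-from-0 n₀ with N? 1F | N? 4F
    ... | yes n₁ | _      = all-from-01 n₀ n₁
    ... | no ¬n₁ | yes n₄ = all-from-34 (far-closed 0F 1F 3F tt (λ ()) (λ ()) n₀ ¬n₁) n₄
    ... | no ¬n₁ | no ¬n₄ =
      ⊥-elim (¬n₁ (far-closed 3F 4F 1F tt (λ ()) (λ ()) (far-closed 0F 1F 3F tt (λ ()) (λ ()) n₀ ¬n₁) ¬n₄))

    all-from-1 : N 1F → ∀ k → N k
    all-from-1 n₁ with N? 0F
    ... | yes n₀ = all-from-01 n₀ n₁
    ... | no ¬n₀ = all-from-34 (far-closed 1F 0F 3F tt (λ ()) (λ ()) n₁ ¬n₀)
                               (far-closed 1F 0F 4F tt (λ ()) (λ ()) n₁ ¬n₀)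

    all-from-3 : N 3F → ∀ k → N k
    all-from-3 n₃ with N? 4F
    ... | yes n₄ = all-from-34 n₃ n₄
    ... | no ¬n₄ = all-from-01 (far-closed 3F 4F 0F tt (λ ()) (λ ()) n₃ ¬n₄)
                               (far-closed 3F 4F 1F tt (λ ()) (λ ()) n₃ ¬n₄)

    all-from-4 : N 4F → ∀ k → N k
    all-from-4 n₄ with N? 3F
    ... | yes n₃ = all-from-34 n₃ n₄
    ... | no ¬n₃ = all-from-1 (far-closed 4F 3F 1F tt (λ ()) (λ ()) n₄ ¬n₃)

    all-from-2 : N 2F → ∀ k → N k
    all-from-2 n₂ with N? 1F
    ... | yes n₁ = all-from-1 n₁
    ... | no ¬n₁ = all-from-4 (far-closed 2F 1F 4F tt (λ ()) (λ ()) n₂ ¬n₁)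

    all-from : ∀ i → N i → ∀ k → N k
    all-from 0F = all-from-0
    all-from 1F = all-from-1
    all-from 2F = all-from-2
    all-from 3F = all-from-3
    all-from 4F = all-from-4

  constant-if-run-and-far-closed : (∀ i → N i) ⊎ (∀ i → ¬ N i)
  constant-if-run-and-far-closed with any? N?
  ... | yes (i , nᵢ) = inj₁ (all-from i nᵢ)
  ... | no none      = inj₂ λ i nᵢ → none (i , nᵢ)

-- Growing a connected set in a prime graph

module Growth {n} (G : Graph n) (adj? : Decidable (Adj G)) where

  private
    infix 4 _~_
    _~_ : Fin n → Fin n → Set
    _~_ = Adj G

  Splits : Fin n → Subset n → Set
  Splits w S = ∃₂ λ a b → a ∈ S × b ∈ S × a ~ b × w ~ a × ¬ w ~ b

  splits? : ∀ w S → Dec (Splits w S)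
  splits? w S = any? λ a → any? λ b →
    a ∈? S ×-dec b ∈? S ×-dec adj? a b ×-dec adj? w a ×-dec ¬? (adj? w b)

  StepIn : Subset n → Fin n → Fin n → Set
  StepIn S u v = v ∈ S × u ~ v

  Connected : Subset n → Fin n → Set
  Connected S r = ∀ {s} → s ∈ S → Star (StepIn S) s r

  Star-StepIn-mono : ∀ {S T : Subset n} {s r} → S ⊆ T → Star (StepIn S) s r → Star (StepIn T) s r
  Star-StepIn-mono S⊆T = Star.map λ { (v∈S , u~v) → S⊆T v∈S , u~v }

  connected-∪ : ∀ {S r w} → Connected S r → Splits w S → Connected (S ∪ ⁅ w ⁆) r
  connected-∪ {S} {r} {w} connected (a , _ , a∈S , _ , _ , w~a , _) {s} s∈S∪w
    with x∈p∪q⁻ S ⁅ w ⁆ s∈S∪w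
  ... | inj₁ s∈S = Star-StepIn-mono (p⊆p∪q ⁅ w ⁆) (connected s∈S)
  ... | inj₂ s∈w rewrite x∈⁅y⁆⇒x≡y w s∈w =
    (p⊆p∪q ⁅ w ⁆ a∈S , w~a) ◅ Star-StepIn-mono (p⊆p∪q ⁅ w ⁆) (connected a∈S)

  same-adjacency-along : ∀ {S v s r} → ¬ Splits v S → s ∈ S → Star (StepIn S) s r →
                         (v ~ s → v ~ r) × (v ~ r → v ~ s)
  same-adjacency-along _ _ ε = id , id
  same-adjacency-along {S} {v} unsplit s∈S ((t∈S , s~t) ◅ path) =
    let forth , back = same-adjacency-along unsplit t∈S path
    in forth ∘ keep s∈S t∈S s~t , keep t∈S s∈S (sym G s~t) ∘ back
    where
    keep : ∀ {a b} → a ∈ S → b ∈ S → a ~ b → v ~ a → v ~ b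
    keep {b = b} a∈S b∈S a~b v~a with adj? v b
    ... | yes v~b = v~b
    ... | no  v≁b = ⊥-elim (unsplit (_ , _ , a∈S , b∈S , a~b , v~a , v≁b))

  homogeneous : ∀ {S r} → Connected S r → (∀ {w} → w ∉ S → ¬ Splits w S) → Homogeneous G S
  homogeneous {S} {r} connected unsplit v v∉S = by-root (adj? v r)
    where
    along : ∀ {s} → s ∈ S → (v ~ s → v ~ r) × (v ~ r → v ~ s)
    along s∈S = same-adjacency-along (unsplit v∉S) s∈S (connected s∈S)

    by-root : Dec (v ~ r) → (∀ s → s ∈ S → v ~ s) ⊎ (∀ s → s ∈ S → ¬ v ~ s)
    by-root (yes v~r) = inj₁ λ s s∈S → proj₂ (along s∈S) v~r
    by-root (no  v≁r) = inj₂ λ s s∈S → v≁r ∘ proj₁ (along s∈S)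

  ∈-∪-⁅⁆ : ∀ {S : Subset n} {v w} → v ∈ S ∪ ⁅ w ⁆ → v ∈ S ⊎ v ≡ w
  ∈-∪-⁅⁆ {S} {w = w} v∈ = Sum.map₂ (x∈⁅y⁆⇒x≡y w) (x∈p∪q⁻ S ⁅ w ⁆ v∈)

  ⊂-∪-⁅⁆ : ∀ {S : Subset n} {w} → w ∉ S → S ⊂ S ∪ ⁅ w ⁆
  ⊂-∪-⁅⁆ {S} {w} w∉S = p⊆p∪q ⁅ w ⁆ , w , q⊆p∪q S ⁅ w ⁆ (x∈⁅x⁆ w) , w∉S

  no-growable-property : Prime G → (Good : Subset n → Set) (r : Fin n) →
    (∀ {S} → Good S → Proper S) →
    (∀ {S w} → Good S → w ∉ S → Splits w S → Good (S ∪ ⁅ w ⁆)) →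
    ∀ {S} → Good S → Connected S r → ⊥
  no-growable-property prime Good r proper grow {S} = go S (⊃-wellFounded S)
    where
    go : ∀ S → Acc (_⊃_ {n}) S → Good S → Connected S r → ⊥
    go S (acc larger) good connected with any? (λ w → ¬? (w ∈? S) ×-dec splits? w S)
    ... | yes (w , w∉S , split) =
      go (S ∪ ⁅ w ⁆) (larger (⊂-∪-⁅⁆ w∉S)) (grow good w∉S split) (connected-∪ connected split)
    ... | no none =
      prime S (proper good) (homogeneous connected λ w∉S split → none (_ , w∉S , split))

-- Vertices attached to an induced P₅ in a bull-free graph

module Attachments {n} (G : Graph n) (p : Fin 5 → Fin n) where

  Complete Anticomplete Uniform Apex : Fin n → Set
  Complete v     = ∀ i → Adj G v (p i)
  Anticomplete v = ∀ i → ¬ Adj G v (p i)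
  Uniform v      = Complete v ⊎ Anticomplete v
  Apex v         = Complete v × ∃ λ q → Adj G v q × Anticomplete q

module AroundInducedP₅ {n} (G : Graph n) (bull-free : BullFree G) (adj? : Decidable (Adj G))
                       (p : Fin 5 → Fin n) (p-induced : ∀ i j → Adj P₅ i j ⇔ Adj G (p i) (p j)) where

  private
    infix 4 _~_
    _~_ : Fin n → Fin n → Set
    _~_ = Adj G

  open Attachments G p public

  adjacent : ∀ {i j} → i ─ j → p i ~ p j
  adjacent {i} {j} i─j = Equivalence.to (p-induced i j) ((λ { refl → ─-irrefl i─j }) , inj₁ i─j)

  nonadjacent : ∀ {i j} → ¬ i ─ j → ¬ p i ~ p j
  nonadjacent {i} {j} ¬i─j pi~pj = ¬i─j ([ id , ─-sym ] (proj₂ (Equivalence.from (p-induced i j) pi~pj)))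

  by-bull-freeness : ∀ {A : Set} → Dec A → (¬ A → bull ≼ᵢ G) → A
  by-bull-freeness (yes a) _    = a
  by-bull-freeness (no ¬a) bull = ⊥-elim (bull-free (bull ¬a))

  module _ {u s : Fin n} (u-complete : Complete u) (s-anticomplete : Anticomplete s) where

    misses-both⇒uniform : ∀ {t} → s ~ u → ¬ t ~ u → ¬ t ~ s → Uniform t
    misses-both⇒uniform {t} s~u t≁u t≁s = constant-if-closed-along (adj? t (p 0F)) along
      where
      along : ∀ i j → i ─ j → t ~ p i → t ~ p j
      along i j i─j t~pi = by-bull-freeness (adj? t (p j)) λ t≁pj →
        induced-bull G s u (p i) t (p j)
          s~u (u-complete i) (sym G t~pi) (u-complete j) (adjacent i─j)
          (s-anticomplete i) (t≁s ∘ sym G) (s-anticomplete j) (t≁u ∘ sym G) t≁pj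

    between⇒uniform : ∀ {t} → s ~ t → t ~ u → ¬ s ~ u → Uniform t
    between⇒uniform {t} s~t t~u s≁u = constant-if-closed-across (adj? t (p 0F)) across
      where
      across : ∀ i j → ¬ i ─ j → t ~ p i → t ~ p j
      across i j ¬i─j t~pi = by-bull-freeness (adj? t (p j)) λ t≁pj →
        induced-bull G s t u (p j) (p i)
          s~t t~u (u-complete j) t~pi (u-complete i)
          s≁u (s-anticomplete j) (s-anticomplete i) t≁pj (nonadjacent ¬i─j ∘ sym G)

    sees-only-anticomplete⇒uniform : ∀ {t} → s ~ t → ¬ t ~ u → Uniform t
    sees-only-anticomplete⇒uniform {t} s~t t≁u =
      constant-if-run-and-far-closed (λ i → adj? t (p i)) run-closed far-closed
      where
      run-closed : ∀ i j k → i ─ j → j ─ k → ¬ i ─ k → t ~ p i → t ~ p j → t ~ p k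
      run-closed i j k i─j j─k ¬i─k t~pi t~pj = by-bull-freeness (adj? t (p k)) λ t≁pk →
        induced-bull G s t (p j) (p k) (p i)
          s~t t~pj (adjacent j─k) t~pi (adjacent (─-sym i─j))
          (s-anticomplete j) (s-anticomplete k) (s-anticomplete i) t≁pk (nonadjacent ¬i─k ∘ sym G)

      far-closed : ∀ i j k → i ─ j → ¬ k ─ i → ¬ k ─ j → t ~ p i → ¬ t ~ p j → t ~ p k
      far-closed i j k i─j ¬k─i ¬k─j t~pi t≁pj = by-bull-freeness (adj? t (p k)) λ t≁pk →
        induced-bull G (p k) u (p i) t (p j)
          (sym G (u-complete k)) (u-complete i) (sym G t~pi) (u-complete j) (adjacent i─j)
          (nonadjacent ¬k─i) (t≁pk ∘ sym G) (nonadjacent ¬k─j) (t≁u ∘ sym G) t≁pj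

    between⇒apex : ∀ {t} → s ~ t → t ~ u → ¬ s ~ u → Apex t ⊎ Apex u
    between⇒apex {t} s~t t~u s≁u =
      Sum.map (λ t-complete → t-complete , s , sym G s~t , s-anticomplete)
              (λ t-anticomplete → u-complete , t , sym G t~u , t-anticomplete)
              (between⇒uniform s~t t~u s≁u)

    sees-only-anticomplete⇒apex-or-anticomplete : ∀ {t} → s ~ t → ¬ t ~ u → Apex t ⊎ Anticomplete t
    sees-only-anticomplete⇒apex-or-anticomplete s~t t≁u =
      Sum.map₁ (λ t-complete → t-complete , s , sym G s~t , s-anticomplete)
               (sees-only-anticomplete⇒uniform s~t t≁u)

  apices-see-splitters : ∀ {c w a b} → Apex c → a ~ c → b ~ c → a ~ b → a ~ w → ¬ b ~ w →
                         ¬ Apex w → ¬ Apex a → ¬ Apex b → c ~ w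
  apices-see-splitters {c} {w} {a} {b} (c-complete , y , c~y , y-anticomplete)
                       a~c b~c a~b a~w b≁w w-not-apex a-not-apex b-not-apex with adj? c w
  ... | yes c~w = c~w
  ... | no  c≁w = ⊥-elim (split-on-a~y (adj? a y))
    where
    w≁c : ¬ w ~ c
    w≁c = c≁w ∘ sym G

    w-not-anticomplete : ¬ Anticomplete w
    w-not-anticomplete w-anticomplete =
      [ (λ a-complete → a-not-apex (a-complete , w , a~w , w-anticomplete))
      , (λ a-anticomplete → b-not-apex (b-complete a-anticomplete , a , sym G a~b , a-anticomplete))
      ] (between⇒uniform c-complete w-anticomplete (sym G a~w) a~c w≁c)
      where
      b-complete : Anticomplete a → Complete b
      b-complete a-anticomplete i = by-bull-freeness (adj? b (p i)) λ b≁pi →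
        induced-bull G (p i) c a w b
          (sym G (c-complete i)) (sym G a~c) a~w (sym G b~c) a~b
          (a-anticomplete i ∘ sym G) (w-anticomplete i ∘ sym G) (b≁pi ∘ sym G) c≁w (b≁w ∘ sym G)

    w≁y : ¬ w ~ y
    w≁y w~y = [ w-not-apex , w-not-anticomplete ]
      (sees-only-anticomplete⇒apex-or-anticomplete c-complete y-anticomplete (sym G w~y) w≁c)

    w-complete : Complete w
    w-complete = [ id , ⊥-elim ∘ w-not-anticomplete ]
      (misses-both⇒uniform c-complete y-anticomplete (sym G c~y) w≁c w≁y)

    split-on-a~y : Dec (a ~ y) → ⊥
    split-on-a~y (yes a~y) =
      [ a-not-apex , w-not-apex ] (between⇒apex w-complete y-anticomplete (sym G a~y) a~w (w≁y ∘ sym G))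
    split-on-a~y (no a≁y) =
      [ b-not-apex
      , (λ b-anticomplete → [ a-not-apex , w-not-apex ] (between⇒apex w-complete b-anticomplete (sym G a~b) a~w b≁w))
      ] (sees-only-anticomplete⇒apex-or-anticomplete w-complete y-anticomplete (sym G b~y) b≁w)
      where
      b~y : b ~ y
      b~y = by-bull-freeness (adj? b y) λ b≁y →
        induced-bull G y c a w b
          (sym G c~y) (sym G a~c) a~w (sym G b~c) a~b
          (a≁y ∘ sym G) (w≁y ∘ sym G) (b≁y ∘ sym G) c≁w (b≁w ∘ sym G)

  open Growth G adj?

  record Admissible (S : Subset n) : Set where
    field
      p₀p₁-inside     : p 0F ∈ S × p 1F ∈ S
      apex-free       : ∀ {v} → v ∈ S → ¬ Apex v
      apices-complete : ∀ {c v} → Apex c → v ∈ S → c ~ v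

  admissible-∪ : ∀ {S w} → Admissible S → w ∉ S → Splits w S → Admissible (S ∪ ⁅ w ⁆)
  admissible-∪ {S} {w} admissible _ (a , b , a∈S , b∈S , a~b , w~a , w≁b) = record
    { p₀p₁-inside     = Product.map (p⊆p∪q ⁅ w ⁆) (p⊆p∪q ⁅ w ⁆) p₀p₁-inside
    ; apex-free       = λ v∈ → [ apex-free , (λ { refl → w-not-apex }) ] (∈-∪-⁅⁆ v∈)
    ; apices-complete = λ c-apex v∈ → [ apices-complete c-apex , (λ { refl → sees-w c-apex }) ] (∈-∪-⁅⁆ v∈)
    }
    where
    open Admissible admissible

    w-not-apex : ¬ Apex w
    w-not-apex w-apex = w≁b (apices-complete w-apex b∈S)

    sees-w : ∀ {c} → Apex c → c ~ w
    sees-w c-apex = apices-see-splitters c-apex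
      (sym G (apices-complete c-apex a∈S)) (sym G (apices-complete c-apex b∈S)) a~b (sym G w~a) (w≁b ∘ sym G)
      w-not-apex (apex-free a∈S) (apex-free b∈S)

  admissible⇒proper : ∀ {x S} → Apex x → Admissible S → Proper S
  admissible⇒proper {x} x-apex admissible =
    (p 0F , p 1F , proj₁ p₀p₁-inside , proj₂ p₀p₁-inside ,
       λ p₀≡p₁ → irrefl G (subst (_~ p 1F) p₀≡p₁ (adjacent {0F} {1F} tt))) ,
    x , λ x∈S → apex-free x∈S x-apex
    where open Admissible admissible

  S₀ : Subset n
  S₀ = ⁅ p 0F ⁆ ∪ ⁅ p 1F ⁆

  ∈-S₀ : ∀ {v} → v ∈ S₀ → v ≡ p 0F ⊎ v ≡ p 1F
  ∈-S₀ v∈ = Sum.map (x∈⁅y⁆⇒x≡y _) (x∈⁅y⁆⇒x≡y _) (x∈p∪q⁻ ⁅ p 0F ⁆ ⁅ p 1F ⁆ v∈)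

  admissible₀ : Admissible S₀
  admissible₀ = record
    { p₀p₁-inside     = p⊆p∪q ⁅ p 1F ⁆ (x∈⁅x⁆ (p 0F)) , q⊆p∪q ⁅ p 0F ⁆ ⁅ p 1F ⁆ (x∈⁅x⁆ (p 1F))
    ; apex-free       = λ v∈ → [ (λ { refl → path-not-apex 0F }) , (λ { refl → path-not-apex 1F }) ] (∈-S₀ v∈)
    ; apices-complete = λ (c-complete , _) v∈ →
        [ (λ { refl → c-complete 0F }) , (λ { refl → c-complete 1F }) ] (∈-S₀ v∈)
    }
    where
    path-not-apex : ∀ i → ¬ Apex (p i)
    path-not-apex i (complete , _) = irrefl G (complete i)

  connected₀ : Connected S₀ (p 0F)
  connected₀ v∈ with ∈-S₀ v∈
  ... | inj₁ refl = ε
  ... | inj₂ refl = (proj₁ (Admissible.p₀p₁-inside admissible₀) , adjacent {1F} {0F} tt) ◅ ε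

  no-apex : Prime G → ∀ {x} → ¬ Apex x
  no-apex prime x-apex =
    no-growable-property prime Admissible (p 0F) (admissible⇒proper x-apex) admissible-∪
      admissible₀ connected₀

parasol-apex : ∀ i → Adj parasol 5F (rim i)
parasol-apex 0F = (λ ()) , inj₁ tt
parasol-apex 1F = (λ ()) , inj₁ tt
parasol-apex 2F = (λ ()) , inj₁ tt
parasol-apex 3F = (λ ()) , inj₁ tt
parasol-apex 4F = (λ ()) , inj₁ tt

parasol-handle : ∀ i → ¬ Adj parasol 6F (rim i)
parasol-handle 0F (_ , inj₂ ())
parasol-handle 1F (_ , inj₂ ())
parasol-handle 2F (_ , inj₂ ())
parasol-handle 3F (_ , inj₂ ())
parasol-handle 4F (_ , inj₂ ())

lemma5 : ∀ {n} (G : Graph n) → Prime G → BullFree G → ¬ (parasol ≼ᵢ G)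
lemma5 G prime bull-free parasol≼G@(f , _ , f-induced) =
  -- adjacency need not be decidable, but the goal is a negation
  ¬¬-decidable G λ adj? → AroundInducedP₅.no-apex G bull-free adj? (f ∘ rim) rim-induced prime f₅-apex
  where
  open Attachments G (f ∘ rim)

  P₅≼G : P₅ ≼ᵢ G
  P₅≼G = ≼ᵢ-trans {H = P₅} {K = parasol} {G = G} P₅≼ᵢparasol parasol≼G

  rim-induced : ∀ i j → Adj P₅ i j ⇔ Adj G (f (rim i)) (f (rim j))
  rim-induced = proj₂ (proj₂ P₅≼G)

  f₅-apex : Apex (f 5F)
  f₅-apex =
    (λ i → Equivalence.to (f-induced 5F (rim i)) (parasol-apex i)) ,
    f 6F , Equivalence.to (f-induced 5F 6F) ((λ ()) , inj₁ tt) ,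
    (λ i → parasol-handle i ∘ Equivalence.from (f-induced 6F (rim i)))
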